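{- Let $n\ge1$ and $k\in\{1,\dots,n\}$. Then the number of set-valued tableaux of one-column shape $(1^k)$ with entries in $[n]$ is $$|\mathrm{SVT}((1^k),n)|=\binom{n}{k}\,{}_2F_1\!\left(k,\,k-n;\,k+1;\,-1\right).$$
   Context: A set-valued tableau of shape $\lambda$ with entries in $[n]=\{1,\dots,n\}$ assigns to each box $(i,j)$ of the Young diagram of $\lambda$ a non-empty subset $T_{i,j}\subseteq[n]$ such that $\max T_{i,j}\le \min T_{i,j+1}$ and $\max T_{i,j}<\min T_{i+1,j}$ whenever these boxes exist; $\mathrm{SVT}(\lambda,n)$ denotes the set of such tableaux. The Gauss hypergeometric series is ${}_2F_1(a,b;c;z)=\sum_{m\ge0}\frac{(a)_m(b)_m}{(c)_m}\frac{z^m}{m!}$ with $(a)_m=a(a+1)\cdots(a+m-1)$, $(a)_0=1$; here it is a terminating (finite) sum. -}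

module Defs where

open import Data.Bool using (Bool; true; false)
open import Data.Nat as ℕ using (ℕ; zero; suc)
open import Data.Nat using (_!)
open import Data.Nat.Properties using (_!≢0)
open import Data.Nat.Combinatorics using (_C_)
import Data.Nat.Properties as ℕP
open import Data.Integer as ℤ using (ℤ; +_)
open import Data.Rational as ℚ using (ℚ; _+_; _*_; _/_)
open import Data.Fin using (Fin; _<_)
open import Data.Fin.Subset using (Subset; _∈_; Nonempty)
open import Data.Fin.Subset.Properties using (nonempty?; _∈?_)
open import Data.Fin.Properties using (all?)
import Data.Fin.Properties as FinP
open import Data.Vec using (Vec; []; _∷_)
open import Data.List using (List; []; _∷_; map; concatMap; length; filter)
open import Data.Product using (_×_)
open import Data.Unit using (⊤)
open import Relation.Nullary using (Dec; yes; no; _×-dec_; _→-dec_)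
open import Relation.Unary using (Decidable)

-- The entry set [n] = {1,…,n} is modelled by Fin n = {0,…,n-1}
-- (order-isomorphic via i ↦ i+1).  A filling of the column (1^k) is a
-- vector of k subsets T₁,…,T_k (top to bottom).  The SVT conditions for
-- this shape unfold to: every box is non-empty, and for vertically
-- adjacent boxes max T_i < min T_{i+1}, i.e. every element of T_i is
-- strictly smaller than every element of T_{i+1}.  (There are no
-- horizontally adjacent boxes in a single column.)

_≺_ : ∀ {n} → Subset n → Subset n → Set
A ≺ B = ∀ x y → x ∈ A → y ∈ B → x < y

_≺?_ : ∀ {n} (A B : Subset n) → Dec (A ≺ B)
A ≺? B = all? λ x → all? λ y → (x ∈? A) →-dec ((y ∈? B) →-dec (x FinP.<? y))

ColStrict : ∀ {n k} → Vec (Subset n) k → Set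
ColStrict [] = ⊤
ColStrict (A ∷ []) = ⊤
ColStrict (A ∷ B ∷ T) = A ≺ B × ColStrict (B ∷ T)

colStrict? : ∀ {n k} → Decidable (ColStrict {n} {k})
colStrict? [] = yes _
colStrict? (A ∷ []) = yes _
colStrict? (A ∷ B ∷ T) = (A ≺? B) ×-dec colStrict? (B ∷ T)

AllNonempty : ∀ {n k} → Vec (Subset n) k → Set
AllNonempty [] = ⊤
AllNonempty (A ∷ T) = Nonempty A × AllNonempty T

allNonempty? : ∀ {n k} → Decidable (AllNonempty {n} {k})
allNonempty? [] = yes _
allNonempty? (A ∷ T) = nonempty? A ×-dec allNonempty? T

IsColumnSVT : ∀ {n k} → Vec (Subset n) k → Set
IsColumnSVT T = AllNonempty T × ColStrict T

isColumnSVT? : ∀ {n k} → Decidable (IsColumnSVT {n} {k})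
isColumnSVT? T = allNonempty? T ×-dec colStrict? T

allSubsets : (n : ℕ) → List (Subset n)
allSubsets zero = [] ∷ []
allSubsets (suc n) = concatMap (λ s → (false ∷ s) ∷ (true ∷ s) ∷ []) (allSubsets n)

allFillings : (n k : ℕ) → List (Vec (Subset n) k)
allFillings n zero = [] ∷ []
allFillings n (suc k) =
  concatMap (λ A → map (A ∷_) (allFillings n k)) (allSubsets n)

numColumnSVT : (n k : ℕ) → ℕ
numColumnSVT n k = length (filter isColumnSVT? (allFillings n k))

-- Gauss hypergeometric series 2F1(a, b; c; z) over ℚ, with a b : ℤ and
-- c a positive natural number (so (c)_m ≠ 0).  `F21-upto a b c z N` is
-- the sum of the terms m = 0, …, N.

pochℤ : ℤ → ℕ → ℤ
pochℤ a zero = + 1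
pochℤ a (suc m) = pochℤ a m ℤ.* (a ℤ.+ + m)

pochℕ : ℕ → ℕ → ℕ
pochℕ c zero = 1
pochℕ c (suc m) = pochℕ c m ℕ.* (c ℕ.+ m)

pochℕ-nonZero : ∀ c m → .{{ℕ.NonZero c}} → ℕ.NonZero (pochℕ c m)
pochℕ-nonZero c zero = _
pochℕ-nonZero c (suc m) =
  ℕP.m*n≢0 (pochℕ c m) (c ℕ.+ m) {{pochℕ-nonZero c m}} {{ℕ.≢-nonZero (λ eq → ℕ.≢-nonZero⁻¹ c (ℕP.m+n≡0⇒m≡0 c eq))}}

denom-nonZero : ∀ c m → .{{ℕ.NonZero c}} → ℕ.NonZero (pochℕ c m ℕ.* m !)
denom-nonZero c m = ℕP.m*n≢0 (pochℕ c m) (m !) {{pochℕ-nonZero c m}} {{m !≢0}}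

powℚ : ℚ → ℕ → ℚ
powℚ z zero = ℚ.1ℚ
powℚ z (suc m) = powℚ z m * z

F21-term : ℤ → ℤ → (c : ℕ) → .{{ℕ.NonZero c}} → ℚ → ℕ → ℚ
F21-term a b c z m =
  ((pochℤ a m ℤ.* pochℤ b m) / (pochℕ c m ℕ.* m !)) {{denom-nonZero c m}} * powℚ z m

F21-upto : ℤ → ℤ → (c : ℕ) → .{{ℕ.NonZero c}} → ℚ → ℕ → ℚ
F21-upto a b c z zero = F21-term a b c z zero
F21-upto a b c z (suc N) = F21-upto a b c z N + F21-term a b c z (suc N)

{-# OPTIONS --safe #-}
-- The smallest entry 0 can only lie in the top box.  So a column tableau on n + 1 entries with
-- k + 1 boxes either avoids 0, or has top box {0} ∪ s with s the nonempty top box of a tableau on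
-- the other n entries, or has top box {0} above a tableau with k boxes:
--   N(n+1, k+1) = 2 N(n, k+1) + N(n, k),   N(n, 0) = 1,   N(0, k+1) = 0.
-- By Pascal's rule the same recursion holds for ∑ᵢ C(n,i) c(i,k), where c(i,k), the number of
-- compositions of i into k positive parts, counts the ways to cut the i entries used, in increasing
-- order, into the k boxes (c(i+1,k+1) = C(i,k)).  For n = k + d only i = k + j with j ≤ d
-- contributes, and C(n,k+j) C(k+j-1,k-1) is the j-th term of C(n,k) ₂F₁(k, k-n; k+1; -1): after
-- clearing denominators this is an induction on j using the absorption identities
--   C(n,m+1) (m+1) = C(n,m) (n-m)   and   C(m+1,r) (m+1-r) = C(m,r) (m+1).
module Submission where

module Counting where

  open import Defs
  open import Data.Empty using (⊥-elim)
  import Data.Fin as Fin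
  open import Data.Fin.Subset using (Subset; _∈_; Nonempty; Empty; inside; outside)
  open import Data.Fin.Subset.Properties using (nonempty?)
  open import Data.List using (List; []; _∷_; _++_; map; concatMap; filter; length; upTo; _∷ʳ_)
  open import Data.List.Properties using (map-++; map-∘; map-cong; map-upTo; applyUpTo-∷ʳ)
  open import Data.Nat.ListAction using (sum)
  open import Data.Nat.ListAction.Properties using (sum-++)
  open import Data.Nat as ℕ using (ℕ; zero; suc; _+_; _*_; _∸_; _≤_; _<_; _!; z≤n; s≤s)
  import Data.Nat.Properties as ℕ
  open import Data.Nat.Combinatorics
    using ( _C_; nCk+nC[k+1]≡[n+1]C[k+1]; k>n⇒nCk≡0; nCn≡1; nCk≡n!/k![n-k]!; k![n∸k]!∣n!
          ; [n-k]*[n-k-1]!≡[n-k]!)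
  open import Data.Nat.Combinatorics.Base using (_P′_)
  open import Data.Nat.DivMod using (m/n*n≡m)
  open import Data.Nat.Tactic.RingSolver using (solve-∀)
  open import Data.Product using (_,_; proj₂)
  open import Data.Product.Function.NonDependent.Propositional using (_×-⇔_)
  open import Data.Vec as Vec using (Vec; []; _∷_; here; there)
  open import Data.Vec.Relation.Unary.Any using (Any; here; there)
  open import Function using (_∘_; id; const)
  open import Function.Bundles using (_⇔_; mk⇔; module Equivalence)
  import Function.Properties.Equivalence as ⇔
  open import Relation.Nullary using (Dec; yes; no; ¬_; ¬?)
  open import Relation.Unary using (Decidable)
  open import Relation.Binary.PropositionalEquality
    using (_≡_; refl; sym; trans; cong; cong₂; module ≡-Reasoning)

  private
    variable
      A B : Set
      n k : ℕ

  ∑ : List A → (A → ℕ) → ℕ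
  ∑ xs f = sum (map f xs)

  syntax ∑ xs (λ x → e) = ∑[ x ← xs ] e

  ∑-cong : ∀ xs {f g : A → ℕ} → (∀ x → f x ≡ g x) → ∑ xs f ≡ ∑ xs g
  ∑-cong xs f≗g = cong sum (map-cong f≗g xs)

  ∑-zero : ∀ xs {f : A → ℕ} → (∀ x → f x ≡ 0) → ∑ xs f ≡ 0
  ∑-zero []       f≡0 = refl
  ∑-zero (x ∷ xs) f≡0 = cong₂ _+_ (f≡0 x) (∑-zero xs f≡0)

  ∑-++ : ∀ xs ys (f : A → ℕ) → ∑ (xs ++ ys) f ≡ ∑ xs f + ∑ ys f
  ∑-++ xs ys f = trans (cong sum (map-++ f xs ys)) (sum-++ (map f xs) (map f ys))

  ∑-map : ∀ (g : A → B) xs (f : B → ℕ) → ∑ (map g xs) f ≡ ∑ xs (f ∘ g)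
  ∑-map g xs f = cong sum (sym (map-∘ xs))

  ∑-concatMap : ∀ (h : A → List B) xs (f : B → ℕ) →
    ∑ (concatMap h xs) f ≡ ∑[ x ← xs ] ∑ (h x) f
  ∑-concatMap h []       f = refl
  ∑-concatMap h (x ∷ xs) f =
    trans (∑-++ (h x) (concatMap h xs) f) (cong (∑ (h x) f +_) (∑-concatMap h xs f))

  ∑-distrib-+ : ∀ xs (f g : A → ℕ) → ∑[ x ← xs ] (f x + g x) ≡ ∑ xs f + ∑ xs g
  ∑-distrib-+ []       f g = refl
  ∑-distrib-+ (x ∷ xs) f g = begin
    (f x + g x) + ∑[ y ← xs ] (f y + g y)  ≡⟨ cong (f x + g x +_) (∑-distrib-+ xs f g) ⟩
    (f x + g x) + (∑ xs f + ∑ xs g)        ≡⟨ interchange (f x) (g x) (∑ xs f) (∑ xs g) ⟩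
    (f x + ∑ xs f) + (g x + ∑ xs g)        ∎
    where
    open ≡-Reasoning
    interchange : ∀ a b c d → (a + b) + (c + d) ≡ (a + c) + (b + d)
    interchange = solve-∀

  ∑-*ˡ : ∀ xs c (f : A → ℕ) → ∑[ x ← xs ] (c * f x) ≡ c * ∑ xs f
  ∑-*ˡ []       c f = sym (ℕ.*-zeroʳ c)
  ∑-*ˡ (x ∷ xs) c f =
    trans (cong (c * f x +_) (∑-*ˡ xs c f)) (sym (ℕ.*-distribˡ-+ c (f x) (∑ xs f)))

  ∑-upTo-sucˡ : ∀ m (f : ℕ → ℕ) → ∑ (upTo (suc m)) f ≡ f 0 + ∑[ i ← upTo m ] f (suc i)
  ∑-upTo-sucˡ m f =
    cong (f 0 +_) (trans (cong (λ is → ∑ is f) (sym (map-upTo suc m))) (∑-map suc (upTo m) f))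

  ∑-upTo-sucʳ : ∀ m (f : ℕ → ℕ) → ∑ (upTo (suc m)) f ≡ ∑ (upTo m) f + f m
  ∑-upTo-sucʳ m f = begin
    ∑ (upTo (suc m)) f         ≡⟨ cong (λ is → ∑ is f) (applyUpTo-∷ʳ id m) ⟨
    ∑ (upTo m ∷ʳ m) f          ≡⟨ ∑-++ (upTo m) (m ∷ []) f ⟩
    ∑ (upTo m) f + (f m + 0)   ≡⟨ cong (∑ (upTo m) f +_) (ℕ.+-identityʳ (f m)) ⟩
    ∑ (upTo m) f + f m         ∎
    where open ≡-Reasoning

  ∑-upTo-+ : ∀ k m (f : ℕ → ℕ) → (∀ i → i < k → f i ≡ 0) →
    ∑ (upTo (k + m)) f ≡ ∑[ j ← upTo m ] f (k + j)
  ∑-upTo-+ zero    m f _   = refl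
  ∑-upTo-+ (suc k) m f f≡0 = begin
    ∑ (upTo (suc k + m)) f
      ≡⟨ ∑-upTo-sucˡ (k + m) f ⟩
    f 0 + ∑[ i ← upTo (k + m) ] f (suc i)
      ≡⟨ cong₂ _+_ (f≡0 0 (s≤s z≤n)) (∑-upTo-+ k m (f ∘ suc) f∘suc≡0) ⟩
    ∑[ j ← upTo m ] f (suc k + j)
      ∎
    where
    open ≡-Reasoning
    f∘suc≡0 : ∀ i → i < k → f (suc i) ≡ 0
    f∘suc≡0 i i<k = f≡0 (suc i) (s≤s i<k)

  -- The recursion in the smallest entry

  𝟙 : {P : Set} → Dec P → ℕ
  𝟙 (yes _) = 1
  𝟙 (no _)  = 0

  𝟙-cong : {P Q : Set} → P ⇔ Q → (p : Dec P) (q : Dec Q) → 𝟙 p ≡ 𝟙 q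
  𝟙-cong P⇔Q (yes _) (yes _) = refl
  𝟙-cong P⇔Q (yes p) (no ¬q) = ⊥-elim (¬q (Equivalence.to P⇔Q p))
  𝟙-cong P⇔Q (no ¬p) (yes q) = ⊥-elim (¬p (Equivalence.from P⇔Q q))
  𝟙-cong P⇔Q (no _)  (no _)  = refl

  𝟙-no : {P : Set} (p : Dec P) → ¬ P → 𝟙 p ≡ 0
  𝟙-no (yes p) ¬p = ⊥-elim (¬p p)
  𝟙-no (no _)  ¬p = refl

  length-filter : {P : A → Set} (P? : Decidable P) (xs : List A) →
    length (filter P? xs) ≡ ∑[ x ← xs ] 𝟙 (P? x)
  length-filter P? []       = refl
  length-filter P? (x ∷ xs) with P? x
  ... | yes _ = cong suc (length-filter P? xs)
  ... | no _  = length-filter P? xs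

  ∑-allSubsets-suc : ∀ n (f : Subset (suc n) → ℕ) →
    ∑ (allSubsets (suc n)) f ≡ ∑[ s ← allSubsets n ] (f (outside ∷ s) + f (inside ∷ s))
  ∑-allSubsets-suc n f = trans (∑-concatMap _ (allSubsets n) f)
    (∑-cong (allSubsets n) (λ s → cong (f (outside ∷ s) +_) (ℕ.+-identityʳ (f (inside ∷ s)))))

  ∑-allFillings-suc : ∀ n k (f : Vec (Subset n) (suc k) → ℕ) →
    ∑ (allFillings n (suc k)) f ≡ ∑[ A ← allSubsets n ] ∑[ T ← allFillings n k ] f (A ∷ T)
  ∑-allFillings-suc n k f = trans (∑-concatMap _ (allSubsets n) f)
    (∑-cong (allSubsets n) (λ A → ∑-map (A ∷_) (allFillings n k) f))

  shift : Vec (Subset n) k → Vec (Subset (suc n)) k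
  shift = Vec.map (outside ∷_)

  ∑-allFillings-avoiding-zero : ∀ n k (f : Vec (Subset (suc n)) k → ℕ) →
    (∀ T → Any (Fin.zero ∈_) T → f T ≡ 0) →
    ∑ (allFillings (suc n) k) f ≡ ∑[ T ← allFillings n k ] f (shift T)
  ∑-allFillings-avoiding-zero n zero    f f≡0 = refl
  ∑-allFillings-avoiding-zero n (suc k) f f≡0 = begin
    ∑ (allFillings (suc n) (suc k)) f
      ≡⟨ ∑-allFillings-suc (suc n) k f ⟩
    ∑[ A ← allSubsets (suc n) ] ∑[ T ← allFillings (suc n) k ] f (A ∷ T)
      ≡⟨ ∑-allSubsets-suc n _ ⟩
    ∑[ s ← allSubsets n ] (∑[ T ← allFillings (suc n) k ] f ((outside ∷ s) ∷ T)
                          + ∑[ T ← allFillings (suc n) k ] f ((inside ∷ s) ∷ T))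
      ≡⟨ ∑-cong (allSubsets n) (λ s → cong₂ _+_
           (∑-allFillings-avoiding-zero n k _ (λ T 0∈T → f≡0 _ (there 0∈T)))
           (∑-zero (allFillings (suc n) k) (λ T → f≡0 _ (here here)))) ⟩
    ∑[ s ← allSubsets n ] (∑[ T ← allFillings n k ] f (shift (s ∷ T)) + 0)
      ≡⟨ ∑-cong (allSubsets n) (λ s → ℕ.+-identityʳ _) ⟩
    ∑[ s ← allSubsets n ] ∑[ T ← allFillings n k ] f (shift (s ∷ T))
      ≡⟨ ∑-allFillings-suc n k (f ∘ shift) ⟨
    ∑[ T ← allFillings n (suc k) ] f (shift T)
      ∎
    where open ≡-Reasoning

  Nonempty-outside : {s : Subset n} → Nonempty (outside ∷ s) ⇔ Nonempty s
  Nonempty-outside =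
    mk⇔ (λ { (Fin.suc x , there x∈s) → x , x∈s }) (λ { (x , x∈s) → Fin.suc x , there x∈s })

  Empty-outside : {s : Subset n} → Empty (outside ∷ s) ⇔ Empty s
  Empty-outside = mk⇔ (_∘ Equivalence.from Nonempty-outside) (_∘ Equivalence.to Nonempty-outside)

  AllNonempty-shift : (T : Vec (Subset n) k) → AllNonempty (shift T) ⇔ AllNonempty T
  AllNonempty-shift []      = mk⇔ id id
  AllNonempty-shift (s ∷ T) = Nonempty-outside ×-⇔ AllNonempty-shift T

  ≺-outside : ∀ b (s s′ : Subset n) → (b ∷ s) ≺ (outside ∷ s′) ⇔ s ≺ s′
  ≺-outside b s s′ = mk⇔ to from
    where
    to : (b ∷ s) ≺ (outside ∷ s′) → s ≺ s′
    to b∷s≺ x y x∈s y∈s′ = ℕ.≤-pred (b∷s≺ (Fin.suc x) (Fin.suc y) (there x∈s) (there y∈s′))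
    from : s ≺ s′ → (b ∷ s) ≺ (outside ∷ s′)
    from s≺s′ Fin.zero    (Fin.suc y) _           (there _)    = s≤s z≤n
    from s≺s′ (Fin.suc x) (Fin.suc y) (there x∈s) (there y∈s′) = s≤s (s≺s′ x y x∈s y∈s′)

  ColStrict-shift : ∀ b (s : Subset n) (T : Vec (Subset n) k) →
    ColStrict ((b ∷ s) ∷ shift T) ⇔ ColStrict (s ∷ T)
  ColStrict-shift b s []       = mk⇔ id id
  ColStrict-shift b s (s′ ∷ T) = ≺-outside b s s′ ×-⇔ ColStrict-shift outside s′ T

  ColStrict-empty-top : {s : Subset n} (T : Vec (Subset n) k) → Empty s →
    ColStrict (s ∷ T) ⇔ ColStrict T
  ColStrict-empty-top []       _ = mk⇔ id id
  ColStrict-empty-top (s′ ∷ T) e = mk⇔ proj₂ (λ c → (λ x _ x∈s _ → ⊥-elim (e (x , x∈s))) , c)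

  zero∉lowerBoxes : {A : Subset (suc n)} (T : Vec (Subset (suc n)) k) →
    IsColumnSVT (A ∷ T) → ¬ Any (Fin.zero ∈_) T
  zero∉lowerBoxes (B ∷ T) (((x , x∈A) , _) , (A≺B , _)) (here 0∈B) = ℕ.n≮0 (A≺B x Fin.zero x∈A 0∈B)
  zero∉lowerBoxes (B ∷ T) ((_ , nonempty) , (_ , strict)) (there 0∈T) =
    zero∉lowerBoxes T (nonempty , strict) 0∈T

  IsColumnSVT-outside : (s : Subset n) (T : Vec (Subset n) k) →
    IsColumnSVT ((outside ∷ s) ∷ shift T) ⇔ IsColumnSVT (s ∷ T)
  IsColumnSVT-outside s T = (Nonempty-outside ×-⇔ AllNonempty-shift T) ×-⇔ ColStrict-shift outside s T

  IsColumnSVT-inside : {s : Subset n} (T : Vec (Subset n) k) → Nonempty s →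
    IsColumnSVT ((inside ∷ s) ∷ shift T) ⇔ IsColumnSVT (s ∷ T)
  IsColumnSVT-inside {s = s} T ne =
    (mk⇔ (const ne) (const (Fin.zero , here)) ×-⇔ AllNonempty-shift T) ×-⇔ ColStrict-shift inside s T

  IsColumnSVT-inside-empty : {s : Subset n} (T : Vec (Subset n) k) → Empty s →
    IsColumnSVT ((inside ∷ s) ∷ shift T) ⇔ IsColumnSVT T
  IsColumnSVT-inside-empty {s = s} T e = mk⇔
    (λ { ((_ , ne) , c) → to (AllNonempty-shift T) ne , to strict c })
    (λ { (ne , c) → ((Fin.zero , here) , from (AllNonempty-shift T) ne) , from strict c })
    where
    open Equivalence
    strict : ColStrict ((inside ∷ s) ∷ shift T) ⇔ ColStrict T
    strict = ⇔.trans (ColStrict-shift inside s T) (ColStrict-empty-top T e)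

  empty? : Decidable (Empty {n})
  empty? s = ¬? (nonempty? s)

  χ : Vec (Subset n) k → ℕ
  χ T = 𝟙 (isColumnSVT? T)

  χ-outside : (s : Subset n) (T : Vec (Subset n) k) → χ ((outside ∷ s) ∷ shift T) ≡ χ (s ∷ T)
  χ-outside s T = 𝟙-cong (IsColumnSVT-outside s T) _ _

  χ-inside : (s : Subset n) (T : Vec (Subset n) k) →
    χ ((inside ∷ s) ∷ shift T) ≡ χ (s ∷ T) + 𝟙 (empty? s) * χ T
  χ-inside s T with nonempty? s
  ... | yes ne = trans (𝟙-cong (IsColumnSVT-inside T ne) _ _) (sym (ℕ.+-identityʳ _))
  ... | no e   = trans (𝟙-cong (IsColumnSVT-inside-empty T e) _ _) (sym (ℕ.+-identityʳ _))

  numColumnSVT≡∑χ : ∀ n k → numColumnSVT n k ≡ ∑ (allFillings n k) χ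
  numColumnSVT≡∑χ n k = length-filter isColumnSVT? (allFillings n k)

  numWithTopBox : (n k : ℕ) → Subset n → ℕ
  numWithTopBox n k A = ∑[ T ← allFillings n k ] χ (A ∷ T)

  numColumnSVT-suc : ∀ n k → numColumnSVT n (suc k) ≡ ∑ (allSubsets n) (numWithTopBox n k)
  numColumnSVT-suc n k = trans (numColumnSVT≡∑χ n (suc k)) (∑-allFillings-suc n k χ)

  χ-zero-in-lower-box : (A : Subset (suc n)) (T : Vec (Subset (suc n)) k) →
    Any (Fin.zero ∈_) T → χ (A ∷ T) ≡ 0
  χ-zero-in-lower-box A T 0∈T = 𝟙-no (isColumnSVT? (A ∷ T)) (λ svt → zero∉lowerBoxes T svt 0∈T)

  numWithTopBox-outside : ∀ n k (s : Subset n) → numWithTopBox (suc n) k (outside ∷ s) ≡ numWithTopBox n k s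
  numWithTopBox-outside n k s =
    trans (∑-allFillings-avoiding-zero n k _ (χ-zero-in-lower-box _))
          (∑-cong (allFillings n k) (χ-outside s))

  numWithTopBox-inside : ∀ n k (s : Subset n) →
    numWithTopBox (suc n) k (inside ∷ s) ≡ numWithTopBox n k s + 𝟙 (empty? s) * numColumnSVT n k
  numWithTopBox-inside n k s = begin
    numWithTopBox (suc n) k (inside ∷ s)
      ≡⟨ ∑-allFillings-avoiding-zero n k _ (χ-zero-in-lower-box _) ⟩
    ∑[ T ← allFillings n k ] χ ((inside ∷ s) ∷ shift T)
      ≡⟨ ∑-cong (allFillings n k) (χ-inside s) ⟩
    ∑[ T ← allFillings n k ] (χ (s ∷ T) + 𝟙 (empty? s) * χ T)
      ≡⟨ ∑-distrib-+ (allFillings n k) _ _ ⟩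
    numWithTopBox n k s + ∑[ T ← allFillings n k ] (𝟙 (empty? s) * χ T)
      ≡⟨ cong (numWithTopBox n k s +_) (∑-*ˡ (allFillings n k) (𝟙 (empty? s)) χ) ⟩
    numWithTopBox n k s + 𝟙 (empty? s) * ∑ (allFillings n k) χ
      ≡⟨ cong (λ c → numWithTopBox n k s + 𝟙 (empty? s) * c) (numColumnSVT≡∑χ n k) ⟨
    numWithTopBox n k s + 𝟙 (empty? s) * numColumnSVT n k
      ∎
    where open ≡-Reasoning

  ∑-𝟙-empty : ∀ n → ∑[ s ← allSubsets n ] 𝟙 (empty? s) ≡ 1
  ∑-𝟙-empty zero    = refl
  ∑-𝟙-empty (suc n) = begin
    ∑[ s ← allSubsets (suc n) ] 𝟙 (empty? s)
      ≡⟨ ∑-allSubsets-suc n _ ⟩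
    ∑[ s ← allSubsets n ] (𝟙 (empty? (outside ∷ s)) + 𝟙 (empty? (inside ∷ s)))
      ≡⟨ ∑-cong (allSubsets n) (λ s → cong₂ _+_
           (𝟙-cong Empty-outside (empty? (outside ∷ s)) (empty? s))
           (𝟙-no (empty? (inside ∷ s)) (λ e → e (Fin.zero , here)))) ⟩
    ∑[ s ← allSubsets n ] (𝟙 (empty? s) + 0)
      ≡⟨ ∑-cong (allSubsets n) (λ s → ℕ.+-identityʳ _) ⟩
    ∑[ s ← allSubsets n ] 𝟙 (empty? s)
      ≡⟨ ∑-𝟙-empty n ⟩
    1 ∎
    where open ≡-Reasoning

  numColumnSVT-0-suc : ∀ k → numColumnSVT 0 (suc k) ≡ 0
  numColumnSVT-0-suc k = trans (numColumnSVT-suc 0 k) (cong (_+ 0) (∑-zero (allFillings 0 k) χ[∅∷T]≡0))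
    where
    χ[∅∷T]≡0 : ∀ T → χ ([] ∷ T) ≡ 0
    χ[∅∷T]≡0 T = 𝟙-no (isColumnSVT? ([] ∷ T)) λ { (((() , _) , _) , _) }

  numColumnSVT-suc-suc : ∀ n k →
    numColumnSVT (suc n) (suc k) ≡ numColumnSVT n (suc k) + (numColumnSVT n (suc k) + numColumnSVT n k)
  numColumnSVT-suc-suc n k = begin
    numColumnSVT (suc n) (suc k)
      ≡⟨ numColumnSVT-suc (suc n) k ⟩
    ∑ (allSubsets (suc n)) (numWithTopBox (suc n) k)
      ≡⟨ ∑-allSubsets-suc n _ ⟩
    ∑[ s ← allSubsets n ] (numWithTopBox (suc n) k (outside ∷ s) + numWithTopBox (suc n) k (inside ∷ s))
      ≡⟨ ∑-cong (allSubsets n) (λ s → cong₂ _+_ (numWithTopBox-outside n k s) (numWithTopBox-inside n k s)) ⟩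
    ∑[ s ← allSubsets n ] (numWithTopBox n k s + (numWithTopBox n k s + 𝟙 (empty? s) * N))
      ≡⟨ ∑-distrib-+ (allSubsets n) _ _ ⟩
    ∑ (allSubsets n) (numWithTopBox n k) + ∑[ s ← allSubsets n ] (numWithTopBox n k s + 𝟙 (empty? s) * N)
      ≡⟨ cong (∑ (allSubsets n) (numWithTopBox n k) +_) (∑-distrib-+ (allSubsets n) _ _) ⟩
    ∑ (allSubsets n) (numWithTopBox n k)
      + (∑ (allSubsets n) (numWithTopBox n k) + ∑[ s ← allSubsets n ] (𝟙 (empty? s) * N))
      ≡⟨ cong₂ (λ a b → a + (a + b)) (sym (numColumnSVT-suc n k)) empties ⟩
    numColumnSVT n (suc k) + (numColumnSVT n (suc k) + N)
      ∎
    where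
    open ≡-Reasoning
    N : ℕ
    N = numColumnSVT n k
    empties : ∑[ s ← allSubsets n ] (𝟙 (empty? s) * N) ≡ N
    empties = begin
      ∑[ s ← allSubsets n ] (𝟙 (empty? s) * N)  ≡⟨ ∑-cong (allSubsets n) (λ s → ℕ.*-comm (𝟙 (empty? s)) N) ⟩
      ∑[ s ← allSubsets n ] (N * 𝟙 (empty? s))  ≡⟨ ∑-*ˡ (allSubsets n) N (𝟙 ∘ empty?) ⟩
      N * ∑[ s ← allSubsets n ] 𝟙 (empty? s)    ≡⟨ cong (N *_) (∑-𝟙-empty n) ⟩
      N * 1                                     ≡⟨ ℕ.*-identityʳ N ⟩
      N                                         ∎

  -- The closed form

  compositions : ℕ → ℕ → ℕ
  compositions zero    zero    = 1
  compositions zero    (suc k) = 0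
  compositions (suc i) zero    = 0
  compositions (suc i) (suc k) = i C k

  compositions-suc : ∀ i k → compositions (suc i) (suc k) ≡ compositions i k + compositions i (suc k)
  compositions-suc zero    zero    = refl
  compositions-suc zero    (suc k) = refl
  compositions-suc (suc i) zero    = refl
  compositions-suc (suc i) (suc k) = sym (nCk+nC[k+1]≡[n+1]C[k+1] i k)

  compositions-< : ∀ {i k} → i < k → compositions i k ≡ 0
  compositions-< {zero}  {suc k} _         = refl
  compositions-< {suc i} {suc k} (s≤s i<k) = k>n⇒nCk≡0 i<k

  ∑-binomial-suc : ∀ n (f : ℕ → ℕ) →
    ∑[ i ← upTo (suc (suc n)) ] ((suc n C i) * f i) ≡ ∑[ i ← upTo (suc n) ] ((n C i) * (f i + f (suc i)))
  ∑-binomial-suc n f = begin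
    ∑[ i ← upTo (suc (suc n)) ] ((suc n C i) * f i)
      ≡⟨ ∑-upTo-sucˡ (suc n) (λ i → (suc n C i) * f i) ⟩
    1 * f 0 + ∑[ i ← upTo (suc n) ] ((suc n C suc i) * f (suc i))
      ≡⟨ cong (1 * f 0 +_) (∑-cong (upTo (suc n)) pascal) ⟩
    1 * f 0 + ∑[ i ← upTo (suc n) ] (g i + h i)
      ≡⟨ cong (1 * f 0 +_) (∑-distrib-+ (upTo (suc n)) g h) ⟩
    1 * f 0 + (∑ (upTo (suc n)) g + ∑ (upTo (suc n)) h)
      ≡⟨ cong (λ z → 1 * f 0 + (∑ (upTo (suc n)) g + z)) (∑-upTo-sucʳ n h) ⟩
    1 * f 0 + (∑ (upTo (suc n)) g + (∑ (upTo n) h + (n C suc n) * f (suc n)))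
      ≡⟨ cong (λ c → 1 * f 0 + (∑ (upTo (suc n)) g + (∑ (upTo n) h + c * f (suc n))))
              (k>n⇒nCk≡0 (ℕ.n<1+n n)) ⟩
    1 * f 0 + (∑ (upTo (suc n)) g + (∑ (upTo n) h + 0))
      ≡⟨ rearrange (1 * f 0) (∑ (upTo n) h) (∑ (upTo (suc n)) g) ⟩
    (1 * f 0 + ∑ (upTo n) h) + ∑ (upTo (suc n)) g
      ≡⟨ cong (_+ ∑ (upTo (suc n)) g) (∑-upTo-sucˡ n (λ i → (n C i) * f i)) ⟨
    ∑[ i ← upTo (suc n) ] ((n C i) * f i) + ∑ (upTo (suc n)) g
      ≡⟨ ∑-distrib-+ (upTo (suc n)) (λ i → (n C i) * f i) g ⟨
    ∑[ i ← upTo (suc n) ] ((n C i) * f i + (n C i) * f (suc i))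
      ≡⟨ ∑-cong (upTo (suc n)) (λ i → ℕ.*-distribˡ-+ (n C i) (f i) (f (suc i))) ⟨
    ∑[ i ← upTo (suc n) ] ((n C i) * (f i + f (suc i)))
      ∎
    where
    open ≡-Reasoning
    g h : ℕ → ℕ
    g i = (n C i) * f (suc i)
    h i = (n C suc i) * f (suc i)
    pascal : ∀ i → (suc n C suc i) * f (suc i) ≡ g i + h i
    pascal i = trans (cong (_* f (suc i)) (sym (nCk+nC[k+1]≡[n+1]C[k+1] n i)))
                     (ℕ.*-distribʳ-+ (f (suc i)) (n C i) (n C suc i))
    rearrange : ∀ a x y → a + (y + (x + 0)) ≡ (a + x) + y
    rearrange = solve-∀

  columnCount : ℕ → ℕ → ℕ
  columnCount n k = ∑[ i ← upTo (suc n) ] ((n C i) * compositions i k)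

  columnCount-zero : ∀ n → columnCount n 0 ≡ 1
  columnCount-zero n = trans (∑-upTo-sucˡ n (λ i → (n C i) * compositions i 0))
    (cong (1 +_) (∑-zero (upTo n) (λ i → ℕ.*-zeroʳ (n C suc i))))

  columnCount-suc-suc : ∀ n k →
    columnCount (suc n) (suc k) ≡ columnCount n (suc k) + (columnCount n (suc k) + columnCount n k)
  columnCount-suc-suc n k = begin
    columnCount (suc n) (suc k)
      ≡⟨ ∑-binomial-suc n (λ i → compositions i (suc k)) ⟩
    ∑[ i ← upTo (suc n) ] ((n C i) * (compositions i (suc k) + compositions (suc i) (suc k)))
      ≡⟨ ∑-cong (upTo (suc n)) split ⟩
    ∑[ i ← upTo (suc n) ] (a i + (a i + b i))
      ≡⟨ ∑-distrib-+ (upTo (suc n)) a (λ i → a i + b i) ⟩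
    columnCount n (suc k) + ∑[ i ← upTo (suc n) ] (a i + b i)
      ≡⟨ cong (columnCount n (suc k) +_) (∑-distrib-+ (upTo (suc n)) a b) ⟩
    columnCount n (suc k) + (columnCount n (suc k) + columnCount n k)
      ∎
    where
    open ≡-Reasoning
    a b : ℕ → ℕ
    a i = (n C i) * compositions i (suc k)
    b i = (n C i) * compositions i k
    distribute : ∀ c x y → c * (x + (y + x)) ≡ c * x + (c * x + c * y)
    distribute = solve-∀
    split : ∀ i → (n C i) * (compositions i (suc k) + compositions (suc i) (suc k)) ≡ a i + (a i + b i)
    split i = trans (cong (λ c → (n C i) * (compositions i (suc k) + c)) (compositions-suc i k))
                    (distribute (n C i) (compositions i (suc k)) (compositions i k))

  columnTerm : ℕ → ℕ → ℕ → ℕ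
  columnTerm n k j = (n C (k + j)) * compositions (k + j) k

  columnCount-from-k : ∀ k d → columnCount (k + d) k ≡ ∑[ j ← upTo (suc d) ] columnTerm (k + d) k j
  columnCount-from-k k d =
    trans (cong (λ m → ∑ (upTo m) term) (sym (ℕ.+-suc k d))) (∑-upTo-+ k (suc d) term term≡0)
    where
    term : ℕ → ℕ
    term i = ((k + d) C i) * compositions i k
    term≡0 : ∀ i → i < k → term i ≡ 0
    term≡0 i i<k = trans (cong (((k + d) C i) *_) (compositions-< i<k)) (ℕ.*-zeroʳ ((k + d) C i))

  numColumnSVT≡columnCount : ∀ n k → numColumnSVT n k ≡ columnCount n k
  numColumnSVT≡columnCount n       zero    = sym (columnCount-zero n)
  numColumnSVT≡columnCount zero    (suc k) = numColumnSVT-0-suc k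
  numColumnSVT≡columnCount (suc n) (suc k) = begin
    numColumnSVT (suc n) (suc k)
      ≡⟨ numColumnSVT-suc-suc n k ⟩
    numColumnSVT n (suc k) + (numColumnSVT n (suc k) + numColumnSVT n k)
      ≡⟨ cong₂ (λ a b → a + (a + b)) (numColumnSVT≡columnCount n (suc k)) (numColumnSVT≡columnCount n k) ⟩
    columnCount n (suc k) + (columnCount n (suc k) + columnCount n k)
      ≡⟨ columnCount-suc-suc n k ⟨
    columnCount (suc n) (suc k)
      ∎
    where open ≡-Reasoning

  -- Absorption identities and the hypergeometric terms

  nCk*[k!*[n∸k]!]≡n! : ∀ {n k} → k ≤ n → (n C k) * (k ! * (n ∸ k) !) ≡ n !
  nCk*[k!*[n∸k]!]≡n! {n} {k} k≤n =
    trans (cong (_* (k ! * (n ∸ k) !)) (nCk≡n!/k![n-k]! k≤n)) (m/n*n≡m (k![n∸k]!∣n! k≤n))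
    where instance _ = k ℕ.!* (n ∸ k) !≢0

  nC[1+k]*[1+k]≡nCk*[n∸k] : ∀ n k → (n C suc k) * suc k ≡ (n C k) * (n ∸ k)
  nC[1+k]*[1+k]≡nCk*[n∸k] n k with k ℕ.<? n
  ... | no k≮n = begin
    (n C suc k) * suc k  ≡⟨ cong (_* suc k) (k>n⇒nCk≡0 (s≤s (ℕ.≮⇒≥ k≮n))) ⟩
    0                    ≡⟨ ℕ.*-zeroʳ (n C k) ⟨
    (n C k) * 0          ≡⟨ cong ((n C k) *_) (ℕ.m≤n⇒m∸n≡0 (ℕ.≮⇒≥ k≮n)) ⟨
    (n C k) * (n ∸ k)    ∎
    where open ≡-Reasoning
  ... | yes k<n = ℕ.*-cancelʳ-≡ _ _ (k ! * (n ∸ suc k) !) (begin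
    (n C suc k) * suc k * (k ! * (n ∸ suc k) !)
      ≡⟨ reassoc (n C suc k) (suc k) (k !) ((n ∸ suc k) !) ⟩
    (n C suc k) * (suc k ! * (n ∸ suc k) !)
      ≡⟨ nCk*[k!*[n∸k]!]≡n! k<n ⟩
    n !
      ≡⟨ nCk*[k!*[n∸k]!]≡n! (ℕ.<⇒≤ k<n) ⟨
    (n C k) * (k ! * (n ∸ k) !)
      ≡⟨ cong (λ f → (n C k) * (k ! * f)) ([n-k]*[n-k-1]!≡[n-k]! k<n) ⟨
    (n C k) * (k ! * ((n ∸ k) * (n ∸ suc k) !))
      ≡⟨ reassoc′ (n C k) (n ∸ k) (k !) ((n ∸ suc k) !) ⟩
    (n C k) * (n ∸ k) * (k ! * (n ∸ suc k) !)
      ∎)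
    where
    open ≡-Reasoning
    instance _ = k ℕ.!* (n ∸ suc k) !≢0
    reassoc : ∀ c a f g → c * a * (f * g) ≡ c * (a * f * g)
    reassoc = solve-∀
    reassoc′ : ∀ c a f g → c * (f * (a * g)) ≡ c * a * (f * g)
    reassoc′ = solve-∀

  [1+n]Ck*[1+n∸k]≡nCk*[1+n] : ∀ n k → (suc n C k) * (suc n ∸ k) ≡ (n C k) * suc n
  [1+n]Ck*[1+n∸k]≡nCk*[1+n] n k with k ℕ.≤? n
  ... | no k≰n = begin
    (suc n C k) * (suc n ∸ k)  ≡⟨ cong ((suc n C k) *_) (ℕ.m≤n⇒m∸n≡0 (ℕ.≰⇒> k≰n)) ⟩
    (suc n C k) * 0            ≡⟨ ℕ.*-zeroʳ (suc n C k) ⟩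
    0                          ≡⟨ cong (_* suc n) (k>n⇒nCk≡0 (ℕ.≰⇒> k≰n)) ⟨
    (n C k) * suc n            ∎
    where open ≡-Reasoning
  ... | yes k≤n = ℕ.*-cancelʳ-≡ _ _ (k ! * (n ∸ k) !) (begin
    (suc n C k) * (suc n ∸ k) * (k ! * (n ∸ k) !)
      ≡⟨ reassoc (suc n C k) (suc n ∸ k) (k !) ((n ∸ k) !) ⟩
    (suc n C k) * (k ! * ((suc n ∸ k) * (n ∸ k) !))
      ≡⟨ cong (λ f → (suc n C k) * (k ! * f)) ([n-k]*[n-k-1]!≡[n-k]! (s≤s k≤n)) ⟩
    (suc n C k) * (k ! * (suc n ∸ k) !)
      ≡⟨ nCk*[k!*[n∸k]!]≡n! (ℕ.m≤n⇒m≤1+n k≤n) ⟩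
    suc n * n !
      ≡⟨ cong (suc n *_) (nCk*[k!*[n∸k]!]≡n! k≤n) ⟨
    suc n * ((n C k) * (k ! * (n ∸ k) !))
      ≡⟨ reassoc′ (n C k) (suc n) (k ! * (n ∸ k) !) ⟩
    (n C k) * suc n * (k ! * (n ∸ k) !)
      ∎)
    where
    open ≡-Reasoning
    instance _ = k ℕ.!* (n ∸ k) !≢0
    reassoc : ∀ c a f g → c * a * (f * g) ≡ c * (f * (a * g))
    reassoc = solve-∀
    reassoc′ : ∀ c a f → a * (c * f) ≡ c * a * f
    reassoc′ = solve-∀

  -- d P′ j = d (d-1) ⋯ (d-j+1) is the falling factorial, equal to (-1)ʲ (-d)ⱼ.
  F21-term-cleared : ∀ k d j →
    ((suc k + d) C suc k) * (pochℕ (suc k) j * (d P′ j))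
      ≡ columnTerm (suc k + d) (suc k) j * (pochℕ (suc (suc k)) j * j !)
  F21-term-cleared k d zero rewrite ℕ.+-identityʳ k | nCn≡1 k = sym (ℕ.*-identityʳ _)
  F21-term-cleared k d (suc j) = begin
    N * (pochℕ (suc k) j * (suc k + j) * ((d ∸ j) * (d P′ j)))
      ≡⟨ regroup N (pochℕ (suc k) j) (d P′ j) (suc k + j) (d ∸ j) ⟩
    N * (pochℕ (suc k) j * (d P′ j)) * ((suc k + j) * (d ∸ j))
      ≡⟨ cong (_* ((suc k + j) * (d ∸ j))) (F21-term-cleared k d j) ⟩
    binom j * comps j * P * ((suc k + j) * (d ∸ j))
      ≡⟨ regroup′ (binom j) (comps j) P (suc k + j) (d ∸ j) ⟩
    binom j * (d ∸ j) * (comps j * suc (k + j)) * P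
      ≡⟨ cong₂ (λ a b → a * b * P) absorb₁ absorb₂ ⟩
    binom (suc j) * suc (suc k + j) * (comps (suc j) * suc j) * P
      ≡⟨ regroup″ (binom (suc j)) (comps (suc j)) (pochℕ (suc (suc k)) j) (j !) (suc (suc k + j)) (suc j) ⟩
    binom (suc j) * comps (suc j) * (pochℕ (suc (suc k)) j * (suc (suc k) + j) * (suc j * j !))
      ∎
    where
    open ≡-Reasoning
    n′ N P : ℕ
    n′ = suc k + d
    N = n′ C suc k
    binom comps : ℕ → ℕ
    binom i = n′ C (suc k + i)
    comps i = compositions (suc k + i) (suc k)
    P = pochℕ (suc (suc k)) j * j !
    absorb₁ : binom j * (d ∸ j) ≡ binom (suc j) * suc (suc k + j)
    absorb₁ = begin
      binom j * (d ∸ j)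
        ≡⟨ cong (binom j *_) (ℕ.[m+n]∸[m+o]≡n∸o (suc k) d j) ⟨
      binom j * (n′ ∸ (suc k + j))
        ≡⟨ nC[1+k]*[1+k]≡nCk*[n∸k] n′ (suc k + j) ⟨
      (n′ C suc (suc k + j)) * suc (suc k + j)
        ≡⟨ cong (λ i → (n′ C i) * suc (suc k + j)) (ℕ.+-suc (suc k) j) ⟨
      binom (suc j) * suc (suc k + j)
        ∎
    absorb₂ : comps j * suc (k + j) ≡ comps (suc j) * suc j
    absorb₂ = begin
      comps j * suc (k + j)                  ≡⟨ [1+n]Ck*[1+n∸k]≡nCk*[1+n] (k + j) k ⟨
      (suc (k + j) C k) * (suc (k + j) ∸ k)  ≡⟨ cong (λ i → (i C k) * (i ∸ k)) (ℕ.+-suc k j) ⟨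
      ((k + suc j) C k) * (k + suc j ∸ k)    ≡⟨ cong (comps (suc j) *_) (ℕ.m+n∸m≡n k (suc j)) ⟩
      comps (suc j) * suc j                  ∎
    regroup : ∀ c p f a e → c * (p * a * (e * f)) ≡ c * (p * f) * (a * e)
    regroup = solve-∀
    regroup′ : ∀ a b p s e → a * b * p * (s * e) ≡ a * e * (b * s) * p
    regroup′ = solve-∀
    regroup″ : ∀ a b q f s t → a * s * (b * t) * (q * f) ≡ a * b * (q * s * (t * f))
    regroup″ = solve-∀

open import Defs
open import Data.Nat as ℕ using (ℕ; zero; suc; _≤_; _∸_; _!; NonZero)
import Data.Nat.Properties as ℕ
open import Data.Nat.Combinatorics using (_C_)
open import Data.Nat.Combinatorics.Base using (_P′_)
open import Data.Integer as ℤ using (ℤ; +_; -1ℤ; _^_)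
import Data.Integer.Properties as ℤ
open import Data.Integer.Tactic.RingSolver using (solve-∀)
open import Data.List using (upTo)
open import Data.Rational as ℚ using (ℚ; _*_; _/_; 1ℚ; toℚᵘ)
import Data.Rational.Properties as ℚ
open import Data.Rational.Unnormalised as ℚᵘ using (mkℚᵘ; *≡*)
  renaming (_/_ to _/ᵘ_; _≃_ to _≃ᵘ_; _*_ to _*ᵘ_)
import Data.Rational.Unnormalised.Properties as ℚᵘ
open import Relation.Binary.PropositionalEquality
  using (_≡_; refl; sym; trans; cong; cong₂; module ≡-Reasoning)
open Counting
  using ( ∑; ∑-upTo-sucʳ; columnCount; columnTerm; columnCount-from-k; numColumnSVT≡columnCount
        ; F21-term-cleared)

-- Passage to ℚ

pochℤ-pos : ∀ k j → pochℤ (+ k) j ≡ + pochℕ k j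
pochℤ-pos k zero    = refl
pochℤ-pos k (suc j) =
  trans (cong₂ ℤ._*_ (pochℤ-pos k j) (sym (ℤ.pos-+ k j))) (sym (ℤ.pos-* (pochℕ k j) (k ℕ.+ j)))

pochℤ-neg : ∀ d j → j ≤ d → pochℤ (ℤ.- + d) j ℤ.* -1ℤ ^ j ≡ + (d P′ j)
pochℤ-neg d zero    _   = refl
pochℤ-neg d (suc j) j<d = begin
  pochℤ (ℤ.- + d) j ℤ.* (ℤ.- + d ℤ.+ + j) ℤ.* (-1ℤ ℤ.* -1ℤ ^ j)
    ≡⟨ regroup (pochℤ (ℤ.- + d) j) (+ d) (+ j) (-1ℤ ^ j) ⟩
  pochℤ (ℤ.- + d) j ℤ.* -1ℤ ^ j ℤ.* (+ d ℤ.- + j)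
    ≡⟨ cong₂ ℤ._*_ (pochℤ-neg d j (ℕ.<⇒≤ j<d)) (trans (ℤ.m-n≡m⊖n d j) (ℤ.⊖-≥ (ℕ.<⇒≤ j<d))) ⟩
  + (d P′ j) ℤ.* + (d ∸ j)
    ≡⟨ ℤ.pos-* (d P′ j) (d ∸ j) ⟨
  + ((d P′ j) ℕ.* (d ∸ j))
    ≡⟨ cong +_ (ℕ.*-comm (d P′ j) (d ∸ j)) ⟩
  + (d P′ suc j)
    ∎
  where
  open ≡-Reasoning
  regroup : ∀ p d j s → p ℤ.* (ℤ.- d ℤ.+ j) ℤ.* (-1ℤ ℤ.* s) ≡ p ℤ.* s ℤ.* (d ℤ.- j)
  regroup = solve-∀

m-[m+n]≡-n : ∀ m n → + m ℤ.- + (m ℕ.+ n) ≡ ℤ.- + n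
m-[m+n]≡-n m n = trans (cong (λ x → + m ℤ.- x) (ℤ.pos-+ m n)) (cancel (+ m) (+ n))
  where
  cancel : ∀ x y → x ℤ.- (x ℤ.+ y) ≡ ℤ.- y
  cancel = solve-∀

toℚᵘ-/ : ∀ i d .{{_ : NonZero d}} → toℚᵘ (i / d) ≃ᵘ i /ᵘ d
toℚᵘ-/ i (suc d) = ℚ.toℚᵘ-fromℚᵘ (mkℚᵘ i d)

toℚᵘ-powℚ-[-1] : ∀ j → toℚᵘ (powℚ (ℚ.- 1ℚ) j) ≃ᵘ (-1ℤ ^ j) /ᵘ 1
toℚᵘ-powℚ-[-1] zero    = ℚᵘ.≃-refl
toℚᵘ-powℚ-[-1] (suc j) = begin
  toℚᵘ (powℚ (ℚ.- 1ℚ) j * ℚ.- 1ℚ)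
    ≈⟨ ℚ.toℚᵘ-homo-* (powℚ (ℚ.- 1ℚ) j) (ℚ.- 1ℚ) ⟩
  toℚᵘ (powℚ (ℚ.- 1ℚ) j) *ᵘ toℚᵘ (ℚ.- 1ℚ)
    ≈⟨ ℚᵘ.*-congʳ (toℚᵘ-powℚ-[-1] j) ⟩
  ((-1ℤ ^ j) /ᵘ 1) *ᵘ (-1ℤ /ᵘ 1)
    ≈⟨ *≡* (cong (ℤ._* + 1) (ℤ.*-comm (-1ℤ ^ j) -1ℤ)) ⟩
  (-1ℤ ^ suc j) /ᵘ 1
    ∎
  where open ℚᵘ.≃-Reasoning

[m+n]/1≡m/1+n/1 : ∀ m n → (+ (m ℕ.+ n)) / 1 ≡ (+ m) / 1 ℚ.+ (+ n) / 1
[m+n]/1≡m/1+n/1 m n = ℚ.toℚᵘ-injective (begin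
  toℚᵘ ((+ (m ℕ.+ n)) / 1)
    ≈⟨ toℚᵘ-/ (+ (m ℕ.+ n)) 1 ⟩
  + (m ℕ.+ n) /ᵘ 1
    ≈⟨ *≡* (trans (cong (ℤ._* + 1) (ℤ.pos-+ m n)) (unit (+ m) (+ n))) ⟩
  (+ m /ᵘ 1) ℚᵘ.+ (+ n /ᵘ 1)
    ≈⟨ ℚᵘ.+-cong (toℚᵘ-/ (+ m) 1) (toℚᵘ-/ (+ n) 1) ⟨
  toℚᵘ ((+ m) / 1) ℚᵘ.+ toℚᵘ ((+ n) / 1)
    ≈⟨ ℚ.toℚᵘ-homo-+ ((+ m) / 1) ((+ n) / 1) ⟨
  toℚᵘ ((+ m) / 1 ℚ.+ (+ n) / 1)
    ∎)
  where
  open ℚᵘ.≃-Reasoning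
  unit : ∀ x y → (x ℤ.+ y) ℤ.* + 1 ≡ (x ℤ.* + 1 ℤ.+ y ℤ.* + 1) ℤ.* + 1
  unit = solve-∀

/ᵘ-clear : ∀ (m p s t : ℤ) d .{{_ : NonZero d}} → m ℤ.* (p ℤ.* s) ≡ t ℤ.* + d →
  (m /ᵘ 1) *ᵘ ((p /ᵘ d) *ᵘ (s /ᵘ 1)) ≃ᵘ t /ᵘ 1
/ᵘ-clear m p s t (suc d) eq =
  *≡* (trans (ℤ.*-identityʳ _) (trans eq (cong (λ e → t ℤ.* + suc e) d≡d*1+0)))
  where
  d≡d*1+0 : d ≡ d ℕ.* 1 ℕ.+ 0
  d≡d*1+0 = sym (trans (ℕ.+-identityʳ (d ℕ.* 1)) (ℕ.*-identityʳ d))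

F21-term-at-[-1] : ∀ a b c .{{_ : NonZero c}} j (m t : ℤ) →
  m ℤ.* (pochℤ a j ℤ.* pochℤ b j ℤ.* -1ℤ ^ j) ≡ t ℤ.* + (pochℕ c j ℕ.* j !) →
  (m / 1) * F21-term a b c (ℚ.- 1ℚ) j ≡ t / 1
F21-term-at-[-1] a b c j m t eq = ℚ.toℚᵘ-injective (begin
  toℚᵘ ((m / 1) * ((P / D) * powℚ (ℚ.- 1ℚ) j))
    ≈⟨ ℚ.toℚᵘ-homo-* (m / 1) ((P / D) * powℚ (ℚ.- 1ℚ) j) ⟩
  toℚᵘ (m / 1) *ᵘ toℚᵘ ((P / D) * powℚ (ℚ.- 1ℚ) j)
    ≈⟨ ℚᵘ.*-congˡ {toℚᵘ (m / 1)} (ℚ.toℚᵘ-homo-* (P / D) (powℚ (ℚ.- 1ℚ) j)) ⟩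
  toℚᵘ (m / 1) *ᵘ (toℚᵘ (P / D) *ᵘ toℚᵘ (powℚ (ℚ.- 1ℚ) j))
    ≈⟨ ℚᵘ.*-cong (toℚᵘ-/ m 1) (ℚᵘ.*-cong (toℚᵘ-/ P D) (toℚᵘ-powℚ-[-1] j)) ⟩
  (m /ᵘ 1) *ᵘ ((P /ᵘ D) *ᵘ ((-1ℤ ^ j) /ᵘ 1))
    ≈⟨ /ᵘ-clear m P (-1ℤ ^ j) t D eq ⟩
  t /ᵘ 1
    ≈⟨ toℚᵘ-/ t 1 ⟨
  toℚᵘ (t / 1)
    ∎)
  where
  open ℚᵘ.≃-Reasoning
  P : ℤ
  P = pochℤ a j ℤ.* pochℤ b j
  D : ℕ
  D = pochℕ c j ℕ.* j !
  instance _ = denom-nonZero c j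

module Column (k d : ℕ) where

  n N : ℕ
  n = suc k ℕ.+ d
  N = n C suc k

  a b : ℤ
  a = + suc k
  b = + suc k ℤ.- + n

  F21-term-cleared-ℤ : ∀ j → j ≤ d →
    + N ℤ.* (pochℤ a j ℤ.* pochℤ b j ℤ.* -1ℤ ^ j)
      ≡ + columnTerm n (suc k) j ℤ.* + (pochℕ (suc (suc k)) j ℕ.* j !)
  F21-term-cleared-ℤ j j≤d = begin
    + N ℤ.* (pochℤ a j ℤ.* pochℤ b j ℤ.* -1ℤ ^ j)
      ≡⟨ cong (+ N ℤ.*_) (ℤ.*-assoc (pochℤ a j) (pochℤ b j) (-1ℤ ^ j)) ⟩
    + N ℤ.* (pochℤ a j ℤ.* (pochℤ b j ℤ.* -1ℤ ^ j))
      ≡⟨ cong₂ (λ p b′ → + N ℤ.* (p ℤ.* (pochℤ b′ j ℤ.* -1ℤ ^ j)))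
               (pochℤ-pos (suc k) j) (m-[m+n]≡-n (suc k) d) ⟩
    + N ℤ.* (+ pochℕ (suc k) j ℤ.* (pochℤ (ℤ.- + d) j ℤ.* -1ℤ ^ j))
      ≡⟨ cong (λ x → + N ℤ.* (+ pochℕ (suc k) j ℤ.* x)) (pochℤ-neg d j j≤d) ⟩
    + N ℤ.* (+ pochℕ (suc k) j ℤ.* + (d P′ j))
      ≡⟨ trans (ℤ.pos-* N _) (cong (+ N ℤ.*_) (ℤ.pos-* (pochℕ (suc k) j) (d P′ j))) ⟨
    + (N ℕ.* (pochℕ (suc k) j ℕ.* (d P′ j)))
      ≡⟨ cong +_ (F21-term-cleared k d j) ⟩
    + (columnTerm n (suc k) j ℕ.* (pochℕ (suc (suc k)) j ℕ.* j !))
      ≡⟨ ℤ.pos-* (columnTerm n (suc k) j) _ ⟩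
    + columnTerm n (suc k) j ℤ.* + (pochℕ (suc (suc k)) j ℕ.* j !)
      ∎
    where open ≡-Reasoning

  N*F21-term≡columnTerm : ∀ j → j ≤ d →
    ((+ N) / 1) * F21-term a b (suc (suc k)) (ℚ.- 1ℚ) j ≡ (+ columnTerm n (suc k) j) / 1
  N*F21-term≡columnTerm j j≤d =
    F21-term-at-[-1] a b (suc (suc k)) j (+ N) (+ columnTerm n (suc k) j) (F21-term-cleared-ℤ j j≤d)

  N*F21-upto≡∑columnTerm : ∀ m → m ≤ d →
    ((+ N) / 1) * F21-upto a b (suc (suc k)) (ℚ.- 1ℚ) m ≡ (+ ∑ (upTo (suc m)) (columnTerm n (suc k))) / 1
  N*F21-upto≡∑columnTerm zero    _   =
    trans (N*F21-term≡columnTerm 0 ℕ.z≤n) (cong (λ x → (+ x) / 1) (sym (ℕ.+-identityʳ (term 0))))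
    where
    term : ℕ → ℕ
    term = columnTerm n (suc k)
  N*F21-upto≡∑columnTerm (suc m) m<d = begin
    N/1 * (F21-upto a b c z m ℚ.+ F21-term a b c z (suc m))
      ≡⟨ ℚ.*-distribˡ-+ N/1 (F21-upto a b c z m) (F21-term a b c z (suc m)) ⟩
    N/1 * F21-upto a b c z m ℚ.+ N/1 * F21-term a b c z (suc m)
      ≡⟨ cong₂ ℚ._+_ (N*F21-upto≡∑columnTerm m (ℕ.<⇒≤ m<d)) (N*F21-term≡columnTerm (suc m) m<d) ⟩
    (+ ∑ (upTo (suc m)) term) / 1 ℚ.+ (+ term (suc m)) / 1
      ≡⟨ [m+n]/1≡m/1+n/1 (∑ (upTo (suc m)) term) (term (suc m)) ⟨
    (+ (∑ (upTo (suc m)) term ℕ.+ term (suc m))) / 1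
      ≡⟨ cong (λ x → (+ x) / 1) (∑-upTo-sucʳ (suc m) term) ⟨
    (+ ∑ (upTo (suc (suc m))) term) / 1
      ∎
    where
    open ≡-Reasoning
    N/1 z : ℚ
    N/1 = (+ N) / 1
    z = ℚ.- 1ℚ
    c : ℕ
    c = suc (suc k)
    term : ℕ → ℕ
    term = columnTerm n (suc k)

numColumnSVT-as-F21 : ∀ n k d → n ≡ suc k ℕ.+ d →
  (+ numColumnSVT n (suc k)) / 1
    ≡ ((+ (n C suc k)) / 1) * F21-upto (+ suc k) (+ suc k ℤ.- + n) (suc (suc k)) (ℚ.- 1ℚ) d
numColumnSVT-as-F21 _ k d refl = begin
  (+ numColumnSVT n (suc k)) / 1
    ≡⟨ cong (λ x → (+ x) / 1) (numColumnSVT≡columnCount n (suc k)) ⟩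
  (+ columnCount n (suc k)) / 1
    ≡⟨ cong (λ x → (+ x) / 1) (columnCount-from-k (suc k) d) ⟩
  (+ ∑ (upTo (suc d)) (columnTerm n (suc k))) / 1
    ≡⟨ N*F21-upto≡∑columnTerm d ℕ.≤-refl ⟨
  ((+ (n C suc k)) / 1) * F21-upto a b (suc (suc k)) (ℚ.- 1ℚ) d
    ∎
  where
  open ≡-Reasoning
  open Column k d

corollary3p4 : (n k : ℕ) → 1 ≤ n → 1 ≤ k → k ≤ n →
    (+ numColumnSVT n k) / 1
      ≡ ((+ (n C k)) / 1) * F21-upto (+ k) (+ k ℤ.- + n) (suc k) (ℚ.- 1ℚ) (n ∸ k)
corollary3p4 n (suc k) _ _ k≤n = numColumnSVT-as-F21 n k (n ∸ suc k) (sym (ℕ.m+[n∸m]≡n k≤n))
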